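{- Let $G$ be a finite simple connected graph that has at least one perfect matching and has maximum degree $\Delta$. Then \[\mathrm{cf}(G)\le \left(1-\frac{1}{\Delta}\right)|E(G)|.\]
   Context: A perfect matching of $G$ is a set of pairwise disjoint edges covering every vertex. For a perfect matching $M$, a subset $S\subseteq M$ is a forcing set of $M$ if $M$ is the unique perfect matching of $G$ containing $S$. A subset $S\subseteq E(G)$ is a complete forcing set of $G$ if for every perfect matching $M$ of $G$, $S\cap M$ is a forcing set of $M$; $\mathrm{cf}(G)$ is the minimum size of a complete forcing set of $G$. -}

module Defs where

open import Data.Nat using (ℕ; _≤_; _*_; _∸_; suc)
open import Data.Fin using (Fin; _≟_) renaming (_<_ to _<ᶠ_)
open import Data.Fin.Subset using (Subset; _∈_; _⊆_; _∩_; ∣_∣)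
open import Data.List using (List; length; lookup; filter)
open import Data.List.Membership.Propositional using () renaming (_∈_ to _∈ˡ_)
open import Data.List.Relation.Unary.All using (All)
open import Data.List.Relation.Unary.Unique.Propositional using (Unique)
open import Data.Product using (Σ; ∃; ∃-syntax; _×_; _,_; proj₁; proj₂)
open import Data.Sum using (_⊎_)
open import Relation.Binary.PropositionalEquality using (_≡_)
open import Relation.Nullary using (Dec; yes; no)
open import Data.Sum using (inj₁; inj₂)

-- A finite simple graph on vertex set Fin n: a duplicate-free list of edges,
-- each edge {u,v} stored once as the ordered pair (u , v) with u < v
-- (so no loops, no multi-edges).
record Graph (n : ℕ) : Set where
  field
    edges   : List (Fin n × Fin n)
    ordered : All (λ e → proj₁ e <ᶠ proj₂ e) edges
    unique  : Unique edges
open Graph public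

m : ∀ {n} → Graph n → ℕ
m G = length (edges G)

edge : ∀ {n} (G : Graph n) → Fin (m G) → Fin n × Fin n
edge G i = lookup (edges G) i

Incident : ∀ {n} → Fin n → Fin n × Fin n → Set
Incident v (a , b) = (v ≡ a) ⊎ (v ≡ b)

incident? : ∀ {n} (v : Fin n) (e : Fin n × Fin n) → Dec (Incident v e)
incident? v (a , b) with v ≟ a | v ≟ b
... | yes p | _     = yes (inj₁ p)
... | no _  | yes q = yes (inj₂ q)
... | no p  | no q  = no λ { (inj₁ x) → p x ; (inj₂ y) → q y }

degree : ∀ {n} → Graph n → Fin n → ℕ
degree G v = length (filter (incident? v) (edges G))

IsMaxDegree : ∀ {n} → Graph n → ℕ → Set
IsMaxDegree {n} G Δ = (∀ v → degree G v ≤ Δ) × (∃[ v ] degree G v ≡ Δ)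

Adj : ∀ {n} → Graph n → Fin n → Fin n → Set
Adj G u v = ((u , v) ∈ˡ edges G) ⊎ ((v , u) ∈ˡ edges G)

data Walk {n} (G : Graph n) : Fin n → Fin n → Set where
  here : ∀ {u} → Walk G u u
  step : ∀ {u v w} → Adj G u v → Walk G v w → Walk G u w

Connected : ∀ {n} → Graph n → Set
Connected {n} G = (1 ≤ n) × (∀ u v → Walk G u v)

EdgeSet : ∀ {n} → Graph n → Set
EdgeSet G = Subset (m G)

IsPerfectMatching : ∀ {n} (G : Graph n) → EdgeSet G → Set
IsPerfectMatching {n} G M =
  ∀ (v : Fin n) →
    (∃[ i ] (i ∈ M × Incident v (edge G i))) ×
    (∀ i j → i ∈ M → j ∈ M → Incident v (edge G i) → Incident v (edge G j) → i ≡ j)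

IsForcingSet : ∀ {n} (G : Graph n) → EdgeSet G → EdgeSet G → Set
IsForcingSet G M S =
  S ⊆ M × (∀ M′ → IsPerfectMatching G M′ → S ⊆ M′ → M′ ≡ M)

IsCompleteForcingSet : ∀ {n} (G : Graph n) → EdgeSet G → Set
IsCompleteForcingSet G S =
  ∀ M → IsPerfectMatching G M → IsForcingSet G M (S ∩ M)

{-# OPTIONS --safe #-}
module Submission where

-- Let I be a maximal independent set and give every vertex v ∉ I its least neighbour c(v) ∈ I as
-- centre; the edges v c(v) form a star forest F, and S = E ∖ F. If perfect matchings M ≠ M′ agree
-- on S, every edge of M ∖ M′ is a leaf edge v c(v). Walking from c(v) along M′ to a leaf v′ and back
-- along M gives another edge v′ c(v′) of M ∖ M′, and c(v′) < c(v) because c(v) is a neighbour of v′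
-- in I: an infinite descent. For the size, every edge has an end outside I and every v ∉ I has its
-- own forest edge, so |E| ≤ Δ |V ∖ I| ≤ Δ |F|, i.e. Δ |S| ≤ (Δ - 1) |E|.

open import Defs
open import Data.Nat using (ℕ; _≤_; _*_; _∸_)
open import Data.Fin.Subset using (∣_∣)
open import Data.Product using (Σ; ∃; ∃-syntax; _×_)

open import Data.Empty using (⊥-elim)
open import Data.Fin using (Fin; zero; suc; _≟_) renaming (_≤_ to _≤ᶠ_; _<_ to _<ᶠ_)
open import Data.Fin.Induction using (<-wellFounded)
open import Data.Fin.Properties using (0≢1+n; suc-injective; any?; ≤∧≢⇒<)
open import Data.Fin.Subset using (Subset; _∈_; _∉_; _⊆_; _∪_; ∁; ⁅_⁆) renaming (⊥ to ∅)
open import Data.Fin.Subset.Properties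
  using (_∈?_; ∉⊥; x∈⁅x⁆; x∈⁅y⁆⇒x≡y; p⊆p∪q; q⊆p∪q; x∈p∪q⁻; p∩q⊆q; x∈p∩q⁺; x∉∁p⇒x∈p; ∣∁p∣≡n∸∣p∣; ⊆-antisym)
open import Data.List using (List; []; _∷_; length; lookup; filter; allFin)
open import Data.List.Membership.Propositional.Properties using (∈-lookup; ∈-allFin)
open import Data.List.Relation.Unary.All as All using (All; []; _∷_)
open import Data.List.Relation.Unary.AllPairs using (_∷_)
open import Data.List.Relation.Unary.Unique.Propositional using (Unique)
open import Data.Nat using (zero; suc; z≤n; s≤s)
open import Data.Nat.Properties
  using (≤-refl; ≤-trans; ≤-reflexive; +-mono-≤; m≤m+n; m≤n+m; *-monoʳ-≤; ∸-monoʳ-≤;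
         *-distribˡ-∸; *-distribʳ-∸; *-identityˡ; *-identityʳ; <-irrefl; <-asym; +-*-semiring; module ≤-Reasoning)
open import Algebra.Properties.Semiring.Sum +-*-semiring using (sum; sum-syntax; ∑-comm; *-distribˡ-sum)
open import Data.Product as Product using (_,_; proj₁; proj₂; ∃₂)
open import Data.Product.Properties using (≡-dec)
open import Data.Sum as Sum using (_⊎_; inj₁; inj₂; swap)
open import Data.Vec using (tabulate)
open import Data.Vec.Properties using ([]=⇒lookup; lookup∘tabulate)
open import Function using (_∘_; _on_)
open import Induction.InfiniteDescent using (Descent; descent∧wf⇒empty)
open import Level using (Level)
import Relation.Binary.Construct.On as On
open import Relation.Binary.PropositionalEquality using (_≡_; _≢_; refl; sym; trans; cong; subst; subst₂)
open import Relation.Nullary using (Dec; yes; no; does; ¬_; ¬?; contradiction)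
open import Relation.Nullary.Decidable using (_⊎-dec_; _×-dec_)
open import Relation.Unary using (Pred; Decidable)

private
  variable
    a p q : Level
    A B : Set a
    k : ℕ

𝟙 : Dec A → ℕ
𝟙 (yes _) = 1
𝟙 (no _)  = 0

count : {P : Pred (Fin k) p} → Decidable P → ℕ
count P? = sum (𝟙 ∘ P?)

sum-mono-≤ : {f g : Fin k → ℕ} → (∀ i → f i ≤ g i) → sum f ≤ sum g
sum-mono-≤ {zero}  f≤g = z≤n
sum-mono-≤ {suc k} f≤g = +-mono-≤ (f≤g zero) (sum-mono-≤ (f≤g ∘ suc))

term≤sum : (f : Fin k → ℕ) (i : Fin k) → f i ≤ sum f
term≤sum f zero    = m≤m+n (f zero) _
term≤sum f (suc i) = ≤-trans (term≤sum (f ∘ suc) i) (m≤n+m _ (f zero))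

sum-ones : sum {k} (λ _ → 1) ≡ k
sum-ones {zero}  = refl
sum-ones {suc k} = cong suc (sum-ones {k})

𝟙-mono : (A? : Dec A) (B? : Dec B) → (A → B) → 𝟙 A? ≤ 𝟙 B?
𝟙-mono (yes _) (yes _) _   = ≤-refl
𝟙-mono (yes x) (no ¬y) A→B = contradiction (A→B x) ¬y
𝟙-mono (no _)  _       _   = z≤n

count-mono : {P : Pred (Fin k) p} {Q : Pred (Fin k) q} (P? : Decidable P) (Q? : Decidable Q) →
             (∀ {i} → P i → Q i) → count P? ≤ count Q?
count-mono P? Q? P⇒Q = sum-mono-≤ (λ i → 𝟙-mono (P? i) (Q? i) P⇒Q)

count-pos : {P : Pred (Fin k) p} (P? : Decidable P) {i : Fin k} → P i → 1 ≤ count P?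
count-pos P? {i} Pi = ≤-trans (𝟙-mono (yes Pi) (P? i) (λ Pi → Pi)) (term≤sum (𝟙 ∘ P?) i)

count-none : {P : Pred (Fin k) p} (P? : Decidable P) → (∀ i → ¬ P i) → count P? ≡ 0
count-none {zero}  P? ¬P = refl
count-none {suc k} P? ¬P with P? zero
... | yes P0 = contradiction P0 (¬P zero)
... | no _   = count-none (P? ∘ suc) (¬P ∘ suc)

count-unique : {P : Pred (Fin k) p} (P? : Decidable P) → (∀ {i j} → P i → P j → i ≡ j) → count P? ≤ 1
count-unique {zero}  P? unique = z≤n
count-unique {suc k} P? unique with P? zero
... | yes P0 = ≤-reflexive (cong suc (count-none (P? ∘ suc) (λ i Pi → 0≢1+n (unique P0 Pi))))
... | no _   = count-unique (P? ∘ suc) (λ Pi Pj → suc-injective (unique Pi Pj))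

𝟙≤count : (A? : Dec A) {P : Pred (Fin k) p} (P? : Decidable P) → (A → ∃ P) → 𝟙 A? ≤ count P?
𝟙≤count (yes x) P? A⇒∃P = count-pos P? (proj₂ (A⇒∃P x))
𝟙≤count (no _)  P? A⇒∃P = z≤n

count≤𝟙 : {P : Pred (Fin k) p} (P? : Decidable P) (A? : Dec A) →
          (∀ {i} → P i → A) → (∀ {i j} → P i → P j → i ≡ j) → count P? ≤ 𝟙 A?
count≤𝟙 P? (yes _) P⇒A unique = count-unique P? unique
count≤𝟙 P? (no ¬A) P⇒A unique = ≤-reflexive (count-none P? λ i → ¬A ∘ P⇒A)

double-counting : ∀ {a b r} {R : Fin a → Fin b → Set r} (R? : ∀ x y → Dec (R x y))
                  {f : Fin a → ℕ} {g : Fin b → ℕ} →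
                  (∀ x → f x ≤ count (R? x)) → (∀ y → count (λ x → R? x y) ≤ g y) →
                  sum f ≤ sum g
double-counting {a} {b} R? {f} {g} f≤ ≤g = begin
  sum f                            ≤⟨ sum-mono-≤ f≤ ⟩
  ∑[ x < a ] count (R? x)          ≡⟨ ∑-comm (λ x y → 𝟙 (R? x y)) ⟩
  ∑[ y < b ] count (λ x → R? x y)  ≤⟨ sum-mono-≤ ≤g ⟩
  sum g                            ∎
  where open ≤-Reasoning

length-filter≡count : {P : Pred A p} (P? : Decidable P) (xs : List A) →
                      length (filter P? xs) ≡ count (λ i → P? (lookup xs i))
length-filter≡count P? []       = refl
length-filter≡count P? (x ∷ xs) with P? x
... | yes _ = cong suc (length-filter≡count P? xs)
... | no _  = length-filter≡count P? xs

lookup-injective : {xs : List A} → Unique xs → ∀ {i j} → lookup xs i ≡ lookup xs j → i ≡ j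
lookup-injective (x∉ ∷ _)  {zero}  {zero}  _ = refl
lookup-injective (x∉ ∷ _)  {zero}  {suc j} e = ⊥-elim (All.lookup x∉ (∈-lookup j) e)
lookup-injective (x∉ ∷ _)  {suc i} {zero}  e = ⊥-elim (All.lookup x∉ (∈-lookup i) (sym e))
lookup-injective (_ ∷ uniq) {suc i} {suc j} e = cong suc (lookup-injective uniq e)

toSubset : {P : Pred (Fin k) p} → Decidable P → Subset k
toSubset P? = tabulate (does ∘ P?)

∈-toSubset⁻ : {P : Pred (Fin k) p} (P? : Decidable P) {i : Fin k} → i ∈ toSubset P? → P i
∈-toSubset⁻ P? {i} i∈ with P? i | trans (sym (lookup∘tabulate (does ∘ P?) i)) ([]=⇒lookup i∈)
... | yes Pi | _ = Pi

∣toSubset∣≡count : {P : Pred (Fin k) p} (P? : Decidable P) → ∣ toSubset P? ∣ ≡ count P?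
∣toSubset∣≡count {zero}  P? = refl
∣toSubset∣≡count {suc k} P? with P? zero
... | yes _ = cong suc (∣toSubset∣≡count (P? ∘ suc))
... | no _  = ∣toSubset∣≡count (P? ∘ suc)

Least : Pred (Fin k) p → Fin k → Set _
Least P i = P i × (∀ {j} → P j → i ≤ᶠ j)

least : {P : Pred (Fin k) p} → Decidable P → ∃ P → ∃ (Least P)
least {zero}  P? (() , _)
least {suc k} P? (w , Pw) with P? zero
least P? (w , Pw)     | yes P0 = zero , P0 , λ _ → z≤n
least P? (zero , P0)  | no ¬P0 = contradiction P0 ¬P0
least P? (suc w , Pw) | no ¬P0 with least (P? ∘ suc) (w , Pw)
... | i , Pi , i-least = suc i , Pi , λ { {zero} P0 → contradiction P0 ¬P0 ; {suc j} Pj → s≤s (i-least Pj) }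

m≤n*o⇒n*[m∸o]≤[n∸1]*m : ∀ m n o → m ≤ n * o → n * (m ∸ o) ≤ (n ∸ 1) * m
m≤n*o⇒n*[m∸o]≤[n∸1]*m m n o m≤n*o = begin
  n * (m ∸ o)    ≡⟨ *-distribˡ-∸ n m o ⟩
  n * m ∸ n * o  ≤⟨ ∸-monoʳ-≤ (n * m) m≤n*o ⟩
  n * m ∸ m      ≡⟨ cong (n * m ∸_) (sym (*-identityˡ m)) ⟩
  n * m ∸ 1 * m  ≡⟨ sym (*-distribʳ-∸ m n 1) ⟩
  (n ∸ 1) * m    ∎
  where open ≤-Reasoning

module _ {n} (G : Graph n) where

  private
    variable
      i j : Fin (m G)
      u v w : Fin n
      I J M M′ : Subset _

  Joins : Fin (m G) → Fin n → Fin n → Set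
  Joins i u v = edge G i ≡ (u , v) ⊎ edge G i ≡ (v , u)

  joins? : ∀ i u v → Dec (Joins i u v)
  joins? i u v = edge G i ≟ₑ (u , v) ⊎-dec edge G i ≟ₑ (v , u)
    where _≟ₑ_ = ≡-dec _≟_ _≟_

  Adjacent : Fin n → Fin n → Set
  Adjacent u v = ∃[ i ] Joins i u v

  Joins-sym : Joins i u v → Joins i v u
  Joins-sym = swap

  Joins⇒Incidentˡ : Joins i u v → Incident u (edge G i)
  Joins⇒Incidentˡ {u = u} (inj₁ e) = subst (Incident u) (sym e) (inj₁ refl)
  Joins⇒Incidentˡ {u = u} (inj₂ e) = subst (Incident u) (sym e) (inj₂ refl)

  Incident⇒Joins : Incident u (edge G i) → ∃[ v ] Joins i u v
  Incident⇒Joins {i = i} (inj₁ refl) = proj₂ (edge G i) , inj₁ refl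
  Incident⇒Joins {i = i} (inj₂ refl) = proj₁ (edge G i) , inj₂ refl

  Joins⇒Incidentʳ : Joins i u v → Incident v (edge G i)
  Joins⇒Incidentʳ = Joins⇒Incidentˡ ∘ Joins-sym

  Joins-endpoints : Joins i u v → Incident w (edge G i) → w ≡ u ⊎ w ≡ v
  Joins-endpoints {w = w} (inj₁ e) w∈i = subst (Incident w) e w∈i
  Joins-endpoints {w = w} (inj₂ e) w∈i = swap (subst (Incident w) e w∈i)

  edge≡⇒< : edge G i ≡ (u , v) → u <ᶠ v
  edge≡⇒< {i = i} e = subst (λ (a , b) → a <ᶠ b) e (All.lookup (ordered G) (∈-lookup i))

  Joins-irrefl : ¬ Joins i v v
  Joins-irrefl (inj₁ e) = <-irrefl refl (edge≡⇒< e)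
  Joins-irrefl (inj₂ e) = <-irrefl refl (edge≡⇒< e)

  Joins-injective : Joins i u v → Joins j u v → i ≡ j
  Joins-injective i~ j~ = lookup-injective (unique G) (same-edge i~ j~)
    where
    same-edge : Joins i u v → Joins j u v → edge G i ≡ edge G j
    same-edge (inj₁ a) (inj₁ b) = trans a (sym b)
    same-edge (inj₂ a) (inj₂ b) = trans a (sym b)
    same-edge (inj₁ a) (inj₂ b) = ⊥-elim (<-asym (edge≡⇒< a) (edge≡⇒< b))
    same-edge (inj₂ a) (inj₁ b) = ⊥-elim (<-asym (edge≡⇒< a) (edge≡⇒< b))

  partner : IsPerfectMatching G M → ∀ v → ∃₂ λ i w → i ∈ M × Joins i v w
  partner pm v with proj₁ (pm v)
  ... | i , i∈M , v∈i = let w , v~w = Incident⇒Joins v∈i in i , w , i∈M , v~w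

  matched-unique : IsPerfectMatching G M → i ∈ M → j ∈ M →
                   Incident v (edge G i) → Incident v (edge G j) → i ≡ j
  matched-unique {v = v} pm = proj₂ (pm v) _ _

  perfectMatching-⊆⇒≡ : IsPerfectMatching G M → IsPerfectMatching G M′ → M ⊆ M′ → M′ ≡ M
  perfectMatching-⊆⇒≡ {M = M} {M′ = M′} pm pm′ M⊆M′ = ⊆-antisym M′⊆M M⊆M′
    where
    M′⊆M : M′ ⊆ M
    M′⊆M {i} i∈M′ with partner pm (proj₁ (edge G i))
    ... | j , _ , j∈M , v~ = subst (_∈ M) (matched-unique pm′ (M⊆M′ j∈M) i∈M′ (Joins⇒Incidentˡ v~) (inj₁ refl)) j∈M

  ∁-isCompleteForcingSet : (T : EdgeSet G) →
    (∀ {M M′} → IsPerfectMatching G M → IsPerfectMatching G M′ → (∀ {i} → i ∈ M → i ∉ M′ → i ∈ T) → M ⊆ M′) →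
    IsCompleteForcingSet G (∁ T)
  ∁-isCompleteForcingSet T rigid M pm = p∩q⊆q (∁ T) M , λ M′ pm′ ∁T∩M⊆M′ →
    perfectMatching-⊆⇒≡ pm pm′ (rigid pm pm′ λ i∈M i∉M′ → x∉∁p⇒x∈p (λ i∈∁T → i∉M′ (∁T∩M⊆M′ (x∈p∩q⁺ (i∈∁T , i∈M)))))

  Independent : Subset n → Set
  Independent I = ∀ {i u v} → Joins i u v → u ∈ I → v ∉ I

  NeighbourIn : Subset n → Fin n → Pred (Fin n) _
  NeighbourIn I v u = u ∈ I × Adjacent v u

  neighbourIn? : ∀ I v → Decidable (NeighbourIn I v)
  neighbourIn? I v u = u ∈? I ×-dec any? (λ i → joins? i v u)

  Dominated : Subset n → Fin n → Set
  Dominated I v = v ∈ I ⊎ ∃ (NeighbourIn I v)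

  dominated? : ∀ I v → Dec (Dominated I v)
  dominated? I v = v ∈? I ⊎-dec any? (neighbourIn? I v)

  Dominated-mono : I ⊆ J → Dominated I v → Dominated J v
  Dominated-mono I⊆J = Sum.map I⊆J (Product.map₂ (Product.map₁ I⊆J))

  insert-independent : Independent I → ¬ Dominated I v → Independent (I ∪ ⁅ v ⁆)
  insert-independent {I = I} {v = v} indep ¬dom {i} {a} {b} a~b a∈ b∈
    with x∈p∪q⁻ I ⁅ v ⁆ a∈ | x∈p∪q⁻ I ⁅ v ⁆ b∈
  ... | inj₁ a∈I | inj₁ b∈I = indep a~b a∈I b∈I
  ... | inj₁ a∈I | inj₂ b∈v = ¬dom (inj₂ (a , a∈I , i , subst (λ x → Joins i x a) (x∈⁅y⁆⇒x≡y v b∈v) (Joins-sym a~b)))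
  ... | inj₂ a∈v | inj₁ b∈I = ¬dom (inj₂ (b , b∈I , i , subst (λ x → Joins i x b) (x∈⁅y⁆⇒x≡y v a∈v) a~b))
  ... | inj₂ a∈v | inj₂ b∈v = Joins-irrefl (subst₂ (Joins i) (x∈⁅y⁆⇒x≡y v a∈v) (x∈⁅y⁆⇒x≡y v b∈v) a~b)

  greedy : (vs : List (Fin n)) → ∃[ I ] (Independent I × All (Dominated I) vs)
  greedy [] = ∅ , (λ _ u∈∅ → contradiction u∈∅ ∉⊥) , []
  greedy (v ∷ vs) with greedy vs
  ... | I , indep , dom with dominated? I v
  ...   | yes v-dom = I , indep , v-dom ∷ dom
  ...   | no ¬v-dom = I ∪ ⁅ v ⁆ , insert-independent indep ¬v-dom
                    , inj₁ (q⊆p∪q I ⁅ v ⁆ (x∈⁅x⁆ v)) ∷ All.map (Dominated-mono (p⊆p∪q ⁅ v ⁆)) dom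

  maximalIndependentSet : ∃[ I ] (Independent I × ∀ v → Dominated I v)
  maximalIndependentSet with greedy (allFin n)
  ... | I , indep , dom = I , indep , λ v → All.lookup dom (∈-allFin v)

  record StarForest : Set where
    field
      centres      : Subset n
      independent  : Independent centres
      centre       : Fin n → Fin n
      centre-least : ∀ {v} → v ∉ centres → Least (NeighbourIn centres v) (centre v)

  starForest : StarForest
  starForest with maximalIndependentSet
  ... | I , indep , dom = record
    { centres = I ; independent = indep ; centre = proj₁ ∘ leastNeighbour ; centre-least = λ {v} → proj₂ (leastNeighbour v) }
    where
    leastNeighbour : ∀ v → ∃[ c ] (v ∉ I → Least (NeighbourIn I v) c)
    leastNeighbour v with dom v
    ... | inj₁ v∈I = v , contradiction v∈I
    ... | inj₂ nb  = Product.map₂ (λ c-least _ → c-least) (least (neighbourIn? I v) nb)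

  module Forest (F : StarForest) where
    open StarForest F

    centre-∈ : v ∉ centres → centre v ∈ centres
    centre-∈ = proj₁ ∘ proj₁ ∘ centre-least

    centre-adjacent : v ∉ centres → Adjacent v (centre v)
    centre-adjacent = proj₂ ∘ proj₁ ∘ centre-least

    LeafEdge : Fin n → Fin (m G) → Set
    LeafEdge v i = v ∉ centres × Joins i v (centre v)

    leafEdge? : ∀ v i → Dec (LeafEdge v i)
    leafEdge? v i = ¬? (v ∈? centres) ×-dec joins? i v (centre v)

    ForestEdge : Pred (Fin (m G)) _
    ForestEdge i = ∃[ v ] LeafEdge v i

    forestEdge? : Decidable ForestEdge
    forestEdge? i = any? (λ v → leafEdge? v i)

    forestEdges : EdgeSet G
    forestEdges = toSubset forestEdge?

    leafEdge-leaf : LeafEdge u i → Incident v (edge G i) → v ∉ centres → v ≡ u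
    leafEdge-leaf (u∉ , u~c) v∈i v∉ with Joins-endpoints u~c v∈i
    ... | inj₁ v≡u = v≡u
    ... | inj₂ v≡c = contradiction (subst (_∈ centres) (sym v≡c) (centre-∈ u∉)) v∉

    module _ (pm : IsPerfectMatching G M) (pm′ : IsPerfectMatching G M′)
             (M∖M′⊆F : ∀ {i} → i ∈ M → i ∉ M′ → ForestEdge i) where

      Switched : Pred (Fin n) _
      Switched v = ∃[ i ] (i ∈ M × i ∉ M′ × LeafEdge v i)

      -- j is the M′-edge at centre t and k the M-edge at its other end t′, which is a leaf by
      -- independence; centre t is then a centre adjacent to t′, but not centre t′ itself.
      switched-descent : Descent (_<ᶠ_ on centre) Switched
      switched-descent {t} (i , i∈M , i∉M′ , t∉ , t~ct) with partner pm′ (centre t)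
      ... | j , t′ , j∈M′ , ct~t′ with partner pm t′
      ... | k , _ , k∈M , t′~ = t′ , ≤∧≢⇒< centre-≤ centre-≢ , k , k∈M , k∉M′ , t′-leaf
        where
        t′∉ : t′ ∉ centres
        t′∉ = independent ct~t′ (centre-∈ t∉)

        k∉M′ : k ∉ M′
        k∉M′ k∈M′ = i∉M′ (subst (_∈ M′) (sym i≡j) j∈M′)
          where
          k≡j : k ≡ j
          k≡j = matched-unique pm′ k∈M′ j∈M′ (Joins⇒Incidentˡ t′~) (Joins⇒Incidentʳ ct~t′)
          i≡j : i ≡ j
          i≡j = matched-unique pm i∈M (subst (_∈ M) k≡j k∈M) (Joins⇒Incidentʳ t~ct) (Joins⇒Incidentˡ ct~t′)

        t′-leaf : LeafEdge t′ k
        t′-leaf with M∖M′⊆F k∈M k∉M′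
        ... | s , s-leaf = subst (λ x → LeafEdge x k) (sym (leafEdge-leaf s-leaf (Joins⇒Incidentˡ t′~) t′∉)) s-leaf

        centre-≤ : centre t′ ≤ᶠ centre t
        centre-≤ = proj₂ (centre-least t′∉) (centre-∈ t∉ , j , Joins-sym ct~t′)

        centre-≢ : centre t′ ≢ centre t
        centre-≢ c≡ct = i∉M′ (subst (_∈ M′) j≡i j∈M′)
          where
          k≡i : k ≡ i
          k≡i = matched-unique pm k∈M i∈M (subst (λ x → Incident x (edge G k)) c≡ct (Joins⇒Incidentʳ (proj₂ t′-leaf))) (Joins⇒Incidentʳ t~ct)
          t′≡t : t′ ≡ t
          t′≡t = leafEdge-leaf (t∉ , t~ct) (subst (λ x → Incident t′ (edge G x)) k≡i (Joins⇒Incidentˡ t′~)) t′∉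
          j≡i : j ≡ i
          j≡i = Joins-injective (subst (λ x → Joins j x (centre t)) t′≡t (Joins-sym ct~t′)) t~ct

      M⊆M′ : M ⊆ M′
      M⊆M′ {i} i∈M with i ∈? M′
      ... | yes i∈M′ = i∈M′
      ... | no i∉M′ with M∖M′⊆F i∈M i∉M′
      ...   | v , v-leaf = contradiction (i , i∈M , i∉M′ , v-leaf)
                             (descent∧wf⇒empty switched-descent (On.wellFounded centre <-wellFounded) v)

    ∁forestEdges-isCompleteForcingSet : IsCompleteForcingSet G (∁ forestEdges)
    ∁forestEdges-isCompleteForcingSet = ∁-isCompleteForcingSet forestEdges λ pm pm′ M∖M′⊆F →
      M⊆M′ pm pm′ λ i∈M i∉M′ → ∈-toSubset⁻ forestEdge? (M∖M′⊆F i∈M i∉M′)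

    leaves : ℕ
    leaves = count (λ v → ¬? (v ∈? centres))

    leaves≤∣forestEdges∣ : leaves ≤ ∣ forestEdges ∣
    leaves≤∣forestEdges∣ = begin
      leaves              ≤⟨ double-counting leafEdge? leaf-has-edge edge-has-one-leaf ⟩
      count forestEdge?   ≡⟨ sym (∣toSubset∣≡count forestEdge?) ⟩
      ∣ forestEdges ∣     ∎
      where
      open ≤-Reasoning

      leaf-has-edge : ∀ v → 𝟙 (¬? (v ∈? centres)) ≤ count (leafEdge? v)
      leaf-has-edge v = 𝟙≤count (¬? (v ∈? centres)) (leafEdge? v) λ v∉ →
        let i , v~c = centre-adjacent v∉ in i , v∉ , v~c

      edge-has-one-leaf : ∀ i → count (λ v → leafEdge? v i) ≤ 𝟙 (forestEdge? i)
      edge-has-one-leaf i = count≤𝟙 (λ v → leafEdge? v i) (forestEdge? i) (_ ,_) λ u-leaf v-leaf →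
        sym (leafEdge-leaf u-leaf (Joins⇒Incidentˡ (proj₂ v-leaf)) (proj₁ v-leaf))

    edges≤Δ*leaves : ∀ {Δ} → (∀ v → degree G v ≤ Δ) → m G ≤ Δ * leaves
    edges≤Δ*leaves {Δ} deg≤Δ = begin
      m G                                      ≡⟨ sym sum-ones ⟩
      ∑[ i < m G ] 1                           ≤⟨ double-counting leafEnd? edge-has-leaf-end leaf-degree ⟩
      ∑[ v < n ] (Δ * 𝟙 (¬? (v ∈? centres)))  ≡⟨ sym (*-distribˡ-sum Δ (λ v → 𝟙 (¬? (v ∈? centres)))) ⟩
      Δ * leaves                               ∎
      where
      open ≤-Reasoning

      LeafEnd : Fin (m G) → Fin n → Set
      LeafEnd i v = v ∉ centres × Incident v (edge G i)

      leafEnd? : ∀ i v → Dec (LeafEnd i v)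
      leafEnd? i v = ¬? (v ∈? centres) ×-dec incident? v (edge G i)

      edge-has-leaf-end : ∀ i → 1 ≤ count (leafEnd? i)
      edge-has-leaf-end i with proj₁ (edge G i) ∈? centres
      ... | yes a∈ = count-pos (leafEnd? i) (independent (inj₁ refl) a∈ , inj₂ refl)
      ... | no a∉  = count-pos (leafEnd? i) (a∉ , inj₁ refl)

      leaf-degree : ∀ v → count (λ i → leafEnd? i v) ≤ Δ * 𝟙 (¬? (v ∈? centres))
      leaf-degree v = bound (v ∈? centres)
        where
        bound : (v∈? : Dec (v ∈ centres)) → count (λ i → leafEnd? i v) ≤ Δ * 𝟙 (¬? v∈?)
        bound (yes v∈) = ≤-trans (≤-reflexive (count-none (λ i → leafEnd? i v) λ i (v∉ , _) → v∉ v∈)) z≤n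
        bound (no _)   = begin
          count (λ i → leafEnd? i v)             ≤⟨ count-mono (λ i → leafEnd? i v) _ proj₂ ⟩
          count (λ i → incident? v (edge G i))   ≡⟨ sym (length-filter≡count (incident? v) (edges G)) ⟩
          degree G v                             ≤⟨ deg≤Δ v ⟩
          Δ                                      ≡⟨ sym (*-identityʳ Δ) ⟩
          Δ * 1                                  ∎

corollary3 : ∀ {n} (G : Graph n) (Δ : ℕ) → Connected G → ∃[ M ] IsPerfectMatching G M → IsMaxDegree G Δ → ∃[ S ] (IsCompleteForcingSet G S × Δ * ∣ S ∣ ≤ (Δ ∸ 1) * m G)
corollary3 G Δ _ _ (deg≤Δ , _) = ∁ forestEdges , ∁forestEdges-isCompleteForcingSet , (begin
  Δ * ∣ ∁ forestEdges ∣         ≡⟨ cong (Δ *_) (∣∁p∣≡n∸∣p∣ forestEdges) ⟩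
  Δ * (m G ∸ ∣ forestEdges ∣)   ≤⟨ m≤n*o⇒n*[m∸o]≤[n∸1]*m (m G) Δ _ m≤Δ*∣forestEdges∣ ⟩
  (Δ ∸ 1) * m G                 ∎)
  where
  open Forest G (starForest G)
  open ≤-Reasoning

  m≤Δ*∣forestEdges∣ : m G ≤ Δ * ∣ forestEdges ∣
  m≤Δ*∣forestEdges∣ = ≤-trans (edges≤Δ*leaves deg≤Δ) (*-monoʳ-≤ Δ leaves≤∣forestEdges∣)
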